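{- If $D$ is a rooted tree or a contrafunctional digraph, then $\gamma_1^o(D)=\gamma(D)$.
   Context: All digraphs are finite, without loops or multiple arcs (pairs of opposite arcs allowed). A rooted tree is a connected digraph with a vertex of in-degree $0$ (the root) such that every other vertex has in-degree $1$. A digraph is contrafunctional if every vertex has in-degree $1$. A set $S\subseteq V(D)$ is a dominating set if every vertex of $V(D)\setminus S$ has an in-neighbor in $S$; $\gamma(D)$ is the minimum size of a dominating set. With $\overline{S}=V(D)\setminus S$ and $deg^-_S(v)$ the number of in-neighbors of $v$ in $S$, a set $S$ is a global offensive $1$-alliance of $D$ if $S$ is dominating and $deg^-_S(v)\ge deg^-_{\overline{S}}(v)+1$ for every $v\in\overline{S}$; $\gamma_1^o(D)$ is the minimum size of such a set. -}

module Defs where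

open import Data.Nat using (ℕ; _≤_; _+_)
open import Data.Fin using (Fin)
open import Data.Bool using (Bool; true; false)
open import Data.Vec using (tabulate)
open import Data.Fin.Subset using (Subset; _∈_; _∉_; ∣_∣; _∩_; ∁)
open import Data.Product using (Σ; _×_; ∃; ∃-syntax)
open import Data.Sum using (_⊎_)
open import Relation.Binary.PropositionalEquality using (_≡_)

-- A finite digraph on vertex set Fin n, without loops; arc u v ≡ true means u → v.
-- Multiple arcs are impossible by construction; opposite arcs are allowed.
record Digraph : Set where
  field
    n        : ℕ
    arc      : Fin n → Fin n → Bool
    loopless : ∀ v → arc v v ≡ false
open Digraph public

inNbrs : (D : Digraph) → Fin (n D) → Subset (n D)
inNbrs D v = tabulate (λ u → arc D u v)

indeg : (D : Digraph) → Fin (n D) → ℕ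
indeg D v = ∣ inNbrs D v ∣

indegIn : (D : Digraph) → Subset (n D) → Fin (n D) → ℕ
indegIn D S v = ∣ S ∩ inNbrs D v ∣

-- Weak connectivity: walks in the underlying undirected graph.
data Walk (D : Digraph) : Fin (n D) → Fin (n D) → Set where
  here : ∀ {v} → Walk D v v
  fwd  : ∀ {u w v} → arc D u w ≡ true → Walk D w v → Walk D u v
  bwd  : ∀ {u w v} → arc D w u ≡ true → Walk D w v → Walk D u v

Connected : Digraph → Set
Connected D = ∀ u v → Walk D u v

RootedTree : Digraph → Set
RootedTree D = Connected D ×
  Σ (Fin (n D)) (λ r → indeg D r ≡ 0 × (∀ v → v ≡ r ⊎ indeg D v ≡ 1))

Contrafunctional : Digraph → Set
Contrafunctional D = ∀ v → indeg D v ≡ 1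

Dominating : (D : Digraph) → Subset (n D) → Set
Dominating D S = ∀ v → v ∉ S → ∃[ u ] (u ∈ S × arc D u v ≡ true)

GlobalOffensive1Alliance : (D : Digraph) → Subset (n D) → Set
GlobalOffensive1Alliance D S =
  Dominating D S × (∀ v → v ∉ S → indegIn D (∁ S) v + 1 ≤ indegIn D S v)

IsMinSize : (D : Digraph) → (Subset (n D) → Set) → ℕ → Set
IsMinSize D P k = (∃[ S ] (P S × ∣ S ∣ ≡ k)) × (∀ S → P S → k ≤ ∣ S ∣)

IsDominationNumber : Digraph → ℕ → Set
IsDominationNumber D = IsMinSize D (Dominating D)

IsGlobalOffensive1AllianceNumber : Digraph → ℕ → Set
IsGlobalOffensive1AllianceNumber D = IsMinSize D (GlobalOffensive1Alliance D)

-- In both classes every vertex has in-degree at most 1. A dominating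
-- set S then dominates each outside vertex v through its unique in-neighbour, so v
-- has one in-neighbour in S and none outside: S is already a global offensive
-- 1-alliance. Since every alliance is dominating, the two minima coincide.
module Submission where

open import Defs
open import Data.Nat using (ℕ; suc; _≤_; _+_; z≤n; s≤s)
open import Data.Nat.Properties using (≤-antisym; ≤-trans; ≤-reflexive; +-suc; +-comm; +-monoʳ-≤; module ≤-Reasoning)
open import Data.Sum using (_⊎_; inj₁; inj₂; [_,_])
open import Data.Product using (_,_; proj₁)
open import Data.Bool using (true)
open import Data.Vec using (_∷_; [])
open import Data.Vec.Properties using (lookup⇒[]=; lookup∘tabulate)
open import Data.Fin using (Fin)
open import Data.Fin.Subset using (Subset; _∈_; _∉_; ∣_∣; _∩_; ∁; inside; outside)
open import Data.Fin.Subset.Properties using (x∈p∩q⁺; x∈p⇒∣p-x∣<∣p∣)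
open import Relation.Binary.PropositionalEquality using (_≡_; refl; cong; trans; subst)

∣p∩q∣+∣∁p∩q∣≡∣q∣ : ∀ {m} (p q : Subset m) → ∣ p ∩ q ∣ + ∣ ∁ p ∩ q ∣ ≡ ∣ q ∣
∣p∩q∣+∣∁p∩q∣≡∣q∣ []            []            = refl
∣p∩q∣+∣∁p∩q∣≡∣q∣ (inside  ∷ p) (inside  ∷ q) = cong suc (∣p∩q∣+∣∁p∩q∣≡∣q∣ p q)
∣p∩q∣+∣∁p∩q∣≡∣q∣ (outside ∷ p) (inside  ∷ q) =
  trans (+-suc ∣ p ∩ q ∣ ∣ ∁ p ∩ q ∣) (cong suc (∣p∩q∣+∣∁p∩q∣≡∣q∣ p q))
∣p∩q∣+∣∁p∩q∣≡∣q∣ (inside  ∷ p) (outside ∷ q) = ∣p∩q∣+∣∁p∩q∣≡∣q∣ p q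
∣p∩q∣+∣∁p∩q∣≡∣q∣ (outside ∷ p) (outside ∷ q) = ∣p∩q∣+∣∁p∩q∣≡∣q∣ p q

x∈p⇒1≤∣p∣ : ∀ {m} {x : Fin m} {p : Subset m} → x ∈ p → 1 ≤ ∣ p ∣
x∈p⇒1≤∣p∣ x∈p = ≤-trans (s≤s z≤n) (x∈p⇒∣p-x∣<∣p∣ x∈p)

module _ (D : Digraph) where

  arc⇒∈inNbrs : ∀ {u v} → arc D u v ≡ true → u ∈ inNbrs D v
  arc⇒∈inNbrs {u} {v} u→v =
    lookup⇒[]= u (inNbrs D v) (trans (lookup∘tabulate (λ w → arc D w v) u) u→v)

  indegIn+indegIn-∁≡indeg : ∀ S v → indegIn D S v + indegIn D (∁ S) v ≡ indeg D v
  indegIn+indegIn-∁≡indeg S v = ∣p∩q∣+∣∁p∩q∣≡∣q∣ S (inNbrs D v)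

  arc-from⇒1≤indegIn : ∀ {S u v} → u ∈ S → arc D u v ≡ true → 1 ≤ indegIn D S v
  arc-from⇒1≤indegIn u∈S u→v = x∈p⇒1≤∣p∣ (x∈p∩q⁺ (u∈S , arc⇒∈inNbrs u→v))

  indeg≤1⇒dominating⇒alliance : (∀ v → indeg D v ≤ 1) →
    ∀ S → Dominating D S → GlobalOffensive1Alliance D S
  indeg≤1⇒dominating⇒alliance indeg≤1 S dom = dom , outside-bound
    where
    outside-bound : ∀ v → v ∉ S → indegIn D (∁ S) v + 1 ≤ indegIn D S v
    outside-bound v v∉S with dom v v∉S
    ... | u , u∈S , u→v = begin
      indegIn D (∁ S) v + 1                ≤⟨ +-monoʳ-≤ (indegIn D (∁ S) v) 1≤inS ⟩
      indegIn D (∁ S) v + indegIn D S v    ≡⟨ +-comm (indegIn D (∁ S) v) _ ⟩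
      indegIn D S v + indegIn D (∁ S) v    ≡⟨ indegIn+indegIn-∁≡indeg S v ⟩
      indeg D v                            ≤⟨ indeg≤1 v ⟩
      1                                    ≤⟨ 1≤inS ⟩
      indegIn D S v                        ∎
      where
      open ≤-Reasoning
      1≤inS : 1 ≤ indegIn D S v
      1≤inS = arc-from⇒1≤indegIn u∈S u→v

  rootedTree⇒indeg≤1 : RootedTree D → ∀ v → indeg D v ≤ 1
  rootedTree⇒indeg≤1 (_ , r , indeg-r≡0 , root-or-indeg≡1) v with root-or-indeg≡1 v
  ... | inj₁ refl = ≤-trans (≤-reflexive indeg-r≡0) z≤n
  ... | inj₂ indeg≡1 = ≤-reflexive indeg≡1

  contrafunctional⇒indeg≤1 : Contrafunctional D → ∀ v → indeg D v ≤ 1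
  contrafunctional⇒indeg≤1 indeg≡1 v = ≤-reflexive (indeg≡1 v)

  IsMinSize-mono : ∀ {P Q : Subset (n D) → Set} {p q} → (∀ S → P S → Q S) →
    IsMinSize D Q q → IsMinSize D P p → q ≤ p
  IsMinSize-mono P⊆Q (_ , q-min) ((S , PS , ∣S∣≡p) , _) = subst (_ ≤_) ∣S∣≡p (q-min S (P⊆Q S PS))

proposition2 : (D : Digraph) → RootedTree D ⊎ Contrafunctional D →
    (g a : ℕ) → IsDominationNumber D g → IsGlobalOffensive1AllianceNumber D a → a ≡ g
proposition2 D tree-or-cf g a γ≡g γ₁ᵒ≡a = ≤-antisym
  (IsMinSize-mono D (indeg≤1⇒dominating⇒alliance D indeg≤1) γ₁ᵒ≡a γ≡g)
  (IsMinSize-mono D (λ _ → proj₁) γ≡g γ₁ᵒ≡a)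
  where
  indeg≤1 : ∀ v → indeg D v ≤ 1
  indeg≤1 = [ rootedTree⇒indeg≤1 D , contrafunctional⇒indeg≤1 D ] tree-or-cf
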